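{- Let $D$ be an odd fundamental discriminant coprime to $3$, and let $D' = -3D$. Consider the elliptic curves $E_{D'}: y^2 = x^3 + 16D'$ and $E_D: Y^2 = X^3 + 16\cdot 3^4 D$ over $\mathbb{Q}$, and the isogeny $\hat{\phi}: E_D \to E_{D'}$ given by $$\hat{\phi}((X,Y)) = \left(\frac{X^3 - 2^6 3^3 D'}{9X^2}, \frac{Y(X^3 + 2^7 3^3 D')}{27 X^3}\right).$$ If $P \in E_{D'}(\mathbb{Q})$ is an integral point, i.e. an affine point $(A,B)$ with $A, B \in \mathbb{Z}$, then there is no $Q \in E_D(\mathbb{Q})$ with $\hat{\phi}(Q) = P$.
   Context: An odd fundamental discriminant is a squarefree integer $D \equiv 1 \pmod 4$, $D\neq 1$. The map $\hat{\phi}$ is the rational $3$-isogeny $E_D \to E_{D'}$ with kernel $\{O,(0,\pm 36\sqrt{D})\}$, dual to the $3$-isogeny $E_{D'}\to E_D$ with kernel $\{O,(0,\pm 4\sqrt{D'})\}$. -}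

module Defs where

open import Data.Nat using (ℕ)
import Data.Nat as ℕ
open import Data.Nat.Divisibility using (_∣_)
open import Data.Integer using (ℤ; +_; -_) renaming (_*_ to _*ℤ_; _+_ to _+ℤ_)
import Data.Integer as ℤ
open import Data.Rational using (ℚ; _/_; 1/_; NonZero; _*_; _+_; _-_)
import Data.Rational as ℚ
open import Data.Product using (Σ; _×_; ∃)
open import Relation.Binary.PropositionalEquality using (_≡_; _≢_)
open import Relation.Nullary using (¬_)

SquareFree : ℤ → Set
SquareFree D = ∀ (n : ℕ) → (n ℕ.* n) ∣ ℤ.∣ D ∣ → n ≡ 1

OddFundDisc : ℤ → Set
OddFundDisc D = SquareFree D × (∃ λ (k : ℤ) → D ≡ (+ 4) *ℤ k +ℤ (+ 1)) × (D ≢ + 1)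

CoprimeTo3 : ℤ → Set
CoprimeTo3 D = ¬ (3 ∣ ℤ.∣ D ∣)

ι : ℤ → ℚ
ι n = n / 1

OnEDp : ℤ → ℚ → ℚ → Set
OnEDp D' x y = y * y ≡ x * x * x + ι ((+ 16) *ℤ D')

OnED : ℤ → ℚ → ℚ → Set
OnED D X Y = Y * Y ≡ X * X * X + ι ((+ 16) *ℤ (+ 81) *ℤ D)

-- φ̂(X,Y) for X ≠ 0, with D' the parameter of the target curve:
-- x = (X³ − 2⁶3³D') / (9X²),  y = Y (X³ + 2⁷3³D') / (27X³)
phiHatX : ℤ → (X : ℚ) → .{{NonZero X}} → ℚ
phiHatX D' X = (X * X * X - ι ((+ 1728) *ℤ D')) * ((+ 1) / 9) * (1/ X) * (1/ X)

phiHatY : ℤ → (X : ℚ) → .{{NonZero X}} → ℚ → ℚ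
phiHatY D' X Y = Y * (X * X * X + ι ((+ 3456) *ℤ D')) * ((+ 1) / 27) * (1/ X) * (1/ X) * (1/ X)

-- Write X = n/e in lowest terms. Clearing denominators in the first coordinate of φ̂(X,Y) = (A,B)
-- gives n³ + 2⁶3⁴De³ = 9An²e. Reduced mod 3 this forces 3 ∣ n; dividing by 27 after n = 3m
-- leaves m³ + 2⁶3De³ = 3Am²e, which forces 3 ∣ m; dividing once more after m = 3k leaves
-- 9k³ + 2⁶De³ = 9Ak²e, so 3 ∣ De³ and, as 3 ∤ D, 3 ∣ e — contradicting gcd(n,e) = 1.
module Submission where

open import Defs
open import Data.Integer using (ℤ; +_; -_; _*_)
open import Data.Rational using (ℚ; NonZero)
open import Data.Product using (_×_)
open import Relation.Binary.PropositionalEquality using (_≡_)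
open import Relation.Nullary using (¬_)

open import Data.Empty using (⊥-elim)
open import Data.List using (_∷_; [])
open import Data.Maybe using (nothing)
open import Data.Product using (_,_)
open import Data.Sum using (_⊎_; inj₁; inj₂; [_,_]′; reduce)
open import Level using (0ℓ)
open import Relation.Binary.PropositionalEquality
  using (refl; sym; trans; cong; cong₂; subst; module ≡-Reasoning)
open import Relation.Nullary.Decidable using (toWitness; toWitnessFalse)

open import Data.Nat using (ℕ)
import Data.Nat as ℕ
import Data.Nat.Properties as ℕ
import Data.Nat.Divisibility as ℕ
open import Data.Nat.Coprimality using (Coprime; recompute)
open import Data.Nat.Primality using (Prime; prime?; euclidsLemma)

open import Data.Integer using (_+_; _-_)
import Data.Integer as ℤ
import Data.Integer.Properties as ℤ
open import Data.Integer.Divisibility.Signed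
  using (_∣_; divides; quotient; ∣ᵤ⇒∣; ∣⇒∣ᵤ; ∣m⇒∣m*n; ∣m+n∣n⇒∣m)
open import Data.Integer.GCD using (gcd-zeroʳ)
import Data.Integer.Tactic.RingSolver as ℤ-Solver

import Data.Rational as ℚ
open import Data.Rational using (mkℚ; ↥_; ↧_; 1ℚ; toℚᵘ)
open import Data.Rational.Properties
  using (↥-/; ↧-/; *-inverseˡ; *-identityʳ; *-assoc; +-*-commutativeRing; toℚᵘ-injective;
         toℚᵘ-homo-*; toℚᵘ-homo-+; toℚᵘ-homo‿-; ↥ᵘ-toℚᵘ; ↧ᵘ-toℚᵘ)
open import Data.Rational.Unnormalised using (mkℚᵘ; *≡*; _≃_)
import Data.Rational.Unnormalised.Properties as ℚᵘ
open import Data.Rational.Unnormalised.Properties using (≃-trans; ≃-sym)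
open import Tactic.RingSolver using (solve)
open import Tactic.RingSolver.Core.AlmostCommutativeRing
  using (AlmostCommutativeRing; fromCommutativeRing)

module _ {p : ℕ} (prime : Prime p) where

  ∣*⇒∣⊎∣ : ∀ {a b} → + p ∣ a * b → + p ∣ a ⊎ + p ∣ b
  ∣*⇒∣⊎∣ {a} {b} p∣ab
    with euclidsLemma ℤ.∣ a ∣ ℤ.∣ b ∣ prime (subst (p ℕ.∣_) (ℤ.abs-* a b) (∣⇒∣ᵤ p∣ab))
  ... | inj₁ p∣a = inj₁ (∣ᵤ⇒∣ p∣a)
  ... | inj₂ p∣b = inj₂ (∣ᵤ⇒∣ p∣b)

  ∣cube⇒∣ : ∀ {a} → + p ∣ a * a * a → + p ∣ a
  ∣cube⇒∣ p∣a³ with ∣*⇒∣⊎∣ p∣a³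
  ... | inj₂ p∣a = p∣a
  ... | inj₁ p∣a² = reduce (∣*⇒∣⊎∣ p∣a²)

3-prime : Prime 3
3-prime = toWitness {a? = prime? 3} _

3∣3 : + 3 ∣ + 3
3∣3 = divides (+ 1) refl

3∣9 : + 3 ∣ + 9
3∣9 = divides (+ 3) refl

3∣192 : + 3 ∣ + 192
3∣192 = divides (+ 64) refl

3∣5184 : + 3 ∣ + 5184
3∣5184 = divides (+ 1728) refl

3∤64 : ¬ (+ 3 ∣ + 64)
3∤64 3∣64 = toWitnessFalse {a? = 3 ℕ.∣? 64} _ (∣⇒∣ᵤ 3∣64)

Cubic : (K c A n e : ℤ) → Set
Cubic K c A n e = n * n * n + K * (e * e * e) ≡ c * A * (n * n * e)

Cubic⇒3∣n : ∀ {K c} A n e → + 3 ∣ K → + 3 ∣ c → Cubic K c A n e → + 3 ∣ n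
Cubic⇒3∣n {K} A n e 3∣K 3∣c eq =
  ∣cube⇒∣ 3-prime (∣m+n∣n⇒∣m 3∣lhs (∣m⇒∣m*n (e * e * e) 3∣K))
  where
  3∣lhs : + 3 ∣ n * n * n + K * (e * e * e)
  3∣lhs = subst (+ 3 ∣_) (sym eq) (∣m⇒∣m*n (n * n * e) (∣m⇒∣m*n A 3∣c))

Cubic-descent : ∀ D A n e (3∣n : + 3 ∣ n) →
  Cubic ((+ 5184) * D) (+ 9) A n e → Cubic ((+ 192) * D) (+ 3) A (quotient 3∣n) e
Cubic-descent D A _ e (divides m refl) eq = ℤ.*-cancelˡ-≡ (+ 27) _ _ (begin
  (+ 27) * (m * m * m + (+ 192) * D * (e * e * e))
    ≡⟨ ℤ-Solver.solve (m ∷ D ∷ e ∷ []) ⟩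
  (m * + 3) * (m * + 3) * (m * + 3) + (+ 5184) * D * (e * e * e)
    ≡⟨ eq ⟩
  (+ 9) * A * ((m * + 3) * (m * + 3) * e)
    ≡⟨ ℤ-Solver.solve (A ∷ m ∷ e ∷ []) ⟩
  (+ 27) * ((+ 3) * A * (m * m * e)) ∎)
  where open ≡-Reasoning

Cubic⇒3∣64De³ : ∀ D A m e → + 3 ∣ m →
  Cubic ((+ 192) * D) (+ 3) A m e → + 3 ∣ (+ 64) * D * (e * e * e)
Cubic⇒3∣64De³ D A _ e (divides k refl) eq = divides ((+ 3) * (A * (k * k * e) - k * k * k))
  (ℤ.*-cancelˡ-≡ (+ 3) _ _ (begin
    (+ 3) * ((+ 64) * D * (e * e * e))
      ≡⟨ ℤ-Solver.solve (k ∷ D ∷ e ∷ []) ⟩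
    (k * + 3) * (k * + 3) * (k * + 3) + (+ 192) * D * (e * e * e) - (k * + 3) * (k * + 3) * (k * + 3)
      ≡⟨ cong (_- (k * + 3) * (k * + 3) * (k * + 3)) eq ⟩
    (+ 3) * A * ((k * + 3) * (k * + 3) * e) - (k * + 3) * (k * + 3) * (k * + 3)
      ≡⟨ ℤ-Solver.solve (A ∷ k ∷ e ∷ []) ⟩
    (+ 3) * ((+ 3) * (A * (k * k * e) - k * k * k) * + 3) ∎))
  where open ≡-Reasoning

3∣64De³⇒3∣e : ∀ D e → CoprimeTo3 D → + 3 ∣ (+ 64) * D * (e * e * e) → + 3 ∣ e
3∣64De³⇒3∣e D e 3∤D 3∣64De³ = [ 3∤64D , ∣cube⇒∣ 3-prime ]′ (∣*⇒∣⊎∣ 3-prime 3∣64De³)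
  where
  3∤64D : + 3 ∣ (+ 64) * D → + 3 ∣ e
  3∤64D 3∣64D = ⊥-elim ([ 3∤64 , (λ 3∣D → 3∤D (∣⇒∣ᵤ 3∣D)) ]′ (∣*⇒∣⊎∣ 3-prime 3∣64D))

Cubic-no-coprime-solution : ∀ D A n e → CoprimeTo3 D → Coprime ℤ.∣ n ∣ ℤ.∣ e ∣ →
  ¬ Cubic ((+ 5184) * D) (+ 9) A n e
Cubic-no-coprime-solution D A n e 3∤D coprime eq = 3≢1 (coprime (∣⇒∣ᵤ 3∣n , ∣⇒∣ᵤ 3∣e))
  where
  3∣n : + 3 ∣ n
  3∣n = Cubic⇒3∣n A n e (∣m⇒∣m*n D 3∣5184) 3∣9 eq
  descended : Cubic ((+ 192) * D) (+ 3) A (quotient 3∣n) e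
  descended = Cubic-descent D A n e 3∣n eq
  3∣e : + 3 ∣ e
  3∣e = 3∣64De³⇒3∣e D e 3∤D (Cubic⇒3∣64De³ D A (quotient 3∣n) e
    (Cubic⇒3∣n A (quotient 3∣n) e (∣m⇒∣m*n D 3∣192) 3∣3 descended) descended)
  3≢1 : ¬ (3 ≡ 1)
  3≢1 ()

↥-ι : ∀ a → ↥ (ι a) ≡ a
↥-ι a = trans (sym (ℤ.*-identityʳ _)) (trans (cong (↥ (ι a) *_) (sym (gcd-zeroʳ a))) (↥-/ a 1))

↧-ι : ∀ a → ↧ (ι a) ≡ + 1
↧-ι a = trans (sym (ℤ.*-identityʳ _)) (trans (cong (↧ (ι a) *_) (sym (gcd-zeroʳ a))) (↧-/ a 1))

toℚᵘ-ι : ∀ a → toℚᵘ (ι a) ≃ mkℚᵘ a 0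
toℚᵘ-ι a = *≡* (cong₂ _*_ (trans (↥ᵘ-toℚᵘ (ι a)) (↥-ι a)) (sym (trans (↧ᵘ-toℚᵘ (ι a)) (↧-ι a))))

ι-injective : ∀ {a b} → ι a ≡ ι b → a ≡ b
ι-injective {a} {b} ιa≡ιb = trans (sym (↥-ι a)) (trans (cong ↥_ ιa≡ιb) (↥-ι b))

ι-* : ∀ a b → ι (a * b) ≡ ι a ℚ.* ι b
ι-* a b = toℚᵘ-injective (≃-trans (toℚᵘ-ι (a * b)) (≃-sym (≃-trans (toℚᵘ-homo-* (ι a) (ι b))
  (≃-trans (ℚᵘ.*-cong (toℚᵘ-ι a) (toℚᵘ-ι b)) (*≡* refl)))))

ι-+ : ∀ a b → ι (a + b) ≡ ι a ℚ.+ ι b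
ι-+ a b = toℚᵘ-injective (≃-trans (toℚᵘ-ι (a + b)) (≃-sym (≃-trans (toℚᵘ-homo-+ (ι a) (ι b))
  (≃-trans (ℚᵘ.+-cong (toℚᵘ-ι a) (toℚᵘ-ι b)) (*≡* cross-multiplied)))))
  where
  cross-multiplied : (a * + 1 + b * + 1) * + 1 ≡ (a + b) * + 1
  cross-multiplied = ℤ-Solver.solve (a ∷ b ∷ [])

ι-neg : ∀ a → ι (- a) ≡ ℚ.- ι a
ι-neg a = toℚᵘ-injective (≃-trans (toℚᵘ-ι (- a)) (≃-sym (≃-trans (toℚᵘ-homo‿- (ι a))
  (≃-trans (ℚᵘ.-‿cong (toℚᵘ-ι a)) (*≡* refl)))))

ι-- : ∀ a b → ι (a - b) ≡ ι a ℚ.- ι b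
ι-- a b = trans (ι-+ a (- b)) (cong (ι a ℚ.+_) (ι-neg b))

ι-*³ : ∀ a b c → ι (a * b * c) ≡ ι a ℚ.* ι b ℚ.* ι c
ι-*³ a b c = trans (ι-* (a * b) c) (cong (ℚ._* ι c) (ι-* a b))

p*↧p≡↥p : ∀ p → p ℚ.* ι (↧ p) ≡ ι (↥ p)
p*↧p≡↥p p@(mkℚ n d _) = toℚᵘ-injective (≃-trans (toℚᵘ-homo-* p (ι (↧ p)))
  (≃-trans (ℚᵘ.*-cong {toℚᵘ p} ℚᵘ.≃-refl (toℚᵘ-ι (↧ p)))
    (≃-trans (*≡* cross-multiplied) (≃-sym (toℚᵘ-ι n)))))
  where
  cross-multiplied : (n * + ℕ.suc d) * + 1 ≡ n * + (ℕ.suc d ℕ.* 1)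
  cross-multiplied = trans (ℤ.*-identityʳ _) (cong (λ k → n * + k) (sym (ℕ.*-identityʳ (ℕ.suc d))))

coprime-↥↧ : ∀ p → Coprime ℤ.∣ ↥ p ∣ ℤ.∣ ↧ p ∣
coprime-↥↧ (mkℚ _ _ c) = recompute c

ℚ-ring : AlmostCommutativeRing 0ℓ 0ℓ
ℚ-ring = fromCommutativeRing +-*-commutativeRing (λ _ → nothing)

*-transpose : ∀ {u v x y} → u ℚ.* v ≡ 1ℚ → x ℚ.* u ≡ y → x ≡ y ℚ.* v
*-transpose {u} {v} {x} {y} uv≡1 xu≡y = begin
  x               ≡⟨ sym (*-identityʳ x) ⟩
  x ℚ.* 1ℚ        ≡⟨ cong (x ℚ.*_) (sym uv≡1) ⟩
  x ℚ.* (u ℚ.* v) ≡⟨ sym (*-assoc x u v) ⟩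
  x ℚ.* u ℚ.* v   ≡⟨ cong (ℚ._* v) xu≡y ⟩
  y ℚ.* v         ∎
  where open ≡-Reasoning

phiHatX-cleared : ∀ D' X .{{_ : NonZero X}} a → phiHatX D' X ≡ a →
  X ℚ.* X ℚ.* X ℚ.- ι ((+ 1728) * D') ≡ a ℚ.* X ℚ.* X ℚ.* ι (+ 9)
phiHatX-cleared D' X a φ̂X≡a =
  *-transpose refl (*-transpose (*-inverseˡ X) (*-transpose (*-inverseˡ X) φ̂X≡a))

homogenise : ∀ X e n k a c → X ℚ.* e ≡ n →
  X ℚ.* X ℚ.* X ℚ.- k ≡ a ℚ.* X ℚ.* X ℚ.* c →
  n ℚ.* n ℚ.* n ℚ.- k ℚ.* (e ℚ.* e ℚ.* e) ≡ c ℚ.* a ℚ.* (n ℚ.* n ℚ.* e)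
homogenise X e n k a c Xe≡n eq = begin
  n ℚ.* n ℚ.* n ℚ.- k ℚ.* (e ℚ.* e ℚ.* e)
    ≡⟨ cong (λ t → t ℚ.* t ℚ.* t ℚ.- k ℚ.* (e ℚ.* e ℚ.* e)) (sym Xe≡n) ⟩
  (X ℚ.* e) ℚ.* (X ℚ.* e) ℚ.* (X ℚ.* e) ℚ.- k ℚ.* (e ℚ.* e ℚ.* e)
    ≡⟨ solve (X ∷ e ∷ k ∷ []) ℚ-ring ⟩
  (X ℚ.* X ℚ.* X ℚ.- k) ℚ.* (e ℚ.* e ℚ.* e)
    ≡⟨ cong (ℚ._* (e ℚ.* e ℚ.* e)) eq ⟩
  a ℚ.* X ℚ.* X ℚ.* c ℚ.* (e ℚ.* e ℚ.* e)
    ≡⟨ solve (X ∷ e ∷ a ∷ c ∷ []) ℚ-ring ⟩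
  c ℚ.* a ℚ.* ((X ℚ.* e) ℚ.* (X ℚ.* e) ℚ.* e)
    ≡⟨ cong (λ t → c ℚ.* a ℚ.* (t ℚ.* t ℚ.* e)) Xe≡n ⟩
  c ℚ.* a ℚ.* (n ℚ.* n ℚ.* e) ∎
  where open ≡-Reasoning

ι-reflects-cubic : ∀ K c A n e →
  ι n ℚ.* ι n ℚ.* ι n ℚ.- ι K ℚ.* (ι e ℚ.* ι e ℚ.* ι e) ≡ ι c ℚ.* ι A ℚ.* (ι n ℚ.* ι n ℚ.* ι e) →
  n * n * n - K * (e * e * e) ≡ c * A * (n * n * e)
ι-reflects-cubic K c A n e eq = ι-injective (begin
  ι (n * n * n - K * (e * e * e))
    ≡⟨ ι-- (n * n * n) (K * (e * e * e)) ⟩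
  ι (n * n * n) ℚ.- ι (K * (e * e * e))
    ≡⟨ cong₂ ℚ._-_ (ι-*³ n n n) (trans (ι-* K (e * e * e)) (cong (ι K ℚ.*_) (ι-*³ e e e))) ⟩
  ι n ℚ.* ι n ℚ.* ι n ℚ.- ι K ℚ.* (ι e ℚ.* ι e ℚ.* ι e)
    ≡⟨ eq ⟩
  ι c ℚ.* ι A ℚ.* (ι n ℚ.* ι n ℚ.* ι e)
    ≡⟨ sym (trans (ι-* (c * A) (n * n * e)) (cong₂ ℚ._*_ (ι-* c A) (ι-*³ n n e))) ⟩
  ι (c * A * (n * n * e)) ∎)
  where open ≡-Reasoning

lemma4p7 : (D : ℤ) → OddFundDisc D → CoprimeTo3 D →
    (A B : ℤ) → OnEDp (- ((+ 3) * D)) (ι A) (ι B) →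
    (X Y : ℚ) → .{{_ : NonZero X}} → OnED D X Y →
    ¬ ((phiHatX (- ((+ 3) * D)) X ≡ ι A) × (phiHatY (- ((+ 3) * D)) X Y ≡ ι B))
lemma4p7 D _ 3∤D A _ _ X _ _ (φ̂X≡A , _) =
  Cubic-no-coprime-solution D A (↥ X) (↧ X) 3∤D (coprime-↥↧ X)
    (trans (in-terms-of-D (↥ X) (↧ X)) cleared)
  where
  D' : ℤ
  D' = - ((+ 3) * D)
  cleared : ↥ X * ↥ X * ↥ X - (+ 1728) * D' * (↧ X * ↧ X * ↧ X) ≡ (+ 9) * A * (↥ X * ↥ X * ↧ X)
  cleared = ι-reflects-cubic ((+ 1728) * D') (+ 9) A (↥ X) (↧ X)
    (homogenise X (ι (↧ X)) (ι (↥ X)) (ι ((+ 1728) * D')) (ι A) (ι (+ 9))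
      (p*↧p≡↥p X) (phiHatX-cleared D' X (ι A) φ̂X≡A))
  in-terms-of-D : ∀ n e →
    n * n * n + (+ 5184) * D * (e * e * e) ≡ n * n * n - (+ 1728) * (- ((+ 3) * D)) * (e * e * e)
  in-terms-of-D n e = ℤ-Solver.solve (n ∷ D ∷ e ∷ [])
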